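{- (Subject reduction for $\mathbf{KP}$.) If $\Gamma\vdash_{\mathbf{KP}} t:A$ and $t\to_{\mathbf{KP}} s$, then $\Gamma\vdash_{\mathbf{KP}} s:A$.
   Context: Formulas are built from propositional atoms and $\bot$ using $\to,\land,\lor$; $\neg B$ abbreviates $B\to\bot$. $\mathbf{KP}$-terms: $t,s,u ::= x \mid t\,s \mid \lambda x.t \mid \mathtt{efq}(t) \mid \langle t,s\rangle \mid \pi_i t \mid \mathtt{in}_i t \mid \mathtt{case}\ t\ [y.s_1]\ [y.s_2] \mid \mathtt{hop}(x.t,\ y.s_1,\ y.s_2)$ ($i\in\{1,2\}$), where in $\mathtt{hop}$, $x$ is bound in $t$ and $y$ in $s_1,s_2$; terms are up to $\alpha$-equivalence and $t\{x:=s\}$ is capture-avoiding substitution. $\Gamma\vdash_{\mathbf{KP}} t:A$ ($\Gamma$ a finite set of declarations $x:A$ with distinct variables) is derived by the standard natural-deduction rules of intuitionistic propositional logic: axiom $\Gamma\vdash x:A$ for $(x:A)\in\Gamma$; from $\Gamma,x:A\vdash t:B$ infer $\Gamma\vdash\lambda x.t:A\to B$; from $\Gamma\vdash t:A\to B$ and $\Gamma\vdash s:A$ infer $\Gamma\vdash t\,s:B$; from $\Gamma\vdash t_i:A_i$ infer $\Gamma\vdash\langle t_1,t_2\rangle:A_1\land A_2$; from $\Gamma\vdash t:A_1\land A_2$ infer $\Gamma\vdash\pi_i t:A_i$; from $\Gamma\vdash t:A_i$ infer $\Gamma\vdash\mathtt{in}_i t:A_1\lor A_2$; from $\Gamma\vdash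 t:A_1\lor A_2$ and $\Gamma,y:A_i\vdash s_i:D$ ($i=1,2$) infer $\Gamma\vdash\mathtt{case}\,t\,[y.s_1][y.s_2]:D$; from $\Gamma\vdash t:\bot$ infer $\Gamma\vdash\mathtt{efq}(t):A$; and the Harrop rule: from $\Gamma,x:\neg B\vdash t:A_1\lor A_2$, $\Gamma,y:\neg B\to A_1\vdash s_1:D$, $\Gamma,y:\neg B\to A_2\vdash s_2:D$ infer $\Gamma\vdash\mathtt{hop}(x.t,y.s_1,y.s_2):D$. Weak head contexts: $W::=\Box\mid W\,t\mid\pi_i W\mid\mathtt{case}\ W\ [y.s_1]\ [y.s_2]$, with $W\langle t\rangle$ the hole filled by $t$. Top-level reduction $\mapsto_{\mathbf{KP}}$: $(\lambda x.t)s\mapsto t\{x:=s\}$; $\pi_i\langle t_1,t_2\rangle\mapsto t_i$; $\mathtt{case}\,(\mathtt{in}_i t)\,[y.s_1][y.s_2]\mapsto s_i\{y:=t\}$; $\mathtt{hop}(x.\mathtt{in}_i t,y.s_1,y.s_2)\mapsto s_i\{y:=\lambda x.t\}$; $\mathtt{hop}(x.W\langle\mathtt{efq}(t)\rangle,y.s_1,y.s_2)\mapsto s_1\{y:=\lambda x.\mathtt{efq}(t)\}$. $\to_{\mathbf{KP}}$ is the closure of $\mapsto_{\mathbf{KP}}$ under all term constructors. -}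

module Defs where

open import Data.Nat using (ℕ; zero; suc)
open import Data.List using (List; []; _∷_)

infixr 5 _⇒_
infixr 6 _∨_
infixr 7 _∧_
data Formula : Set where
  atom : ℕ → Formula
  ⊥ₚ   : Formula
  _⇒_  : Formula → Formula → Formula
  _∧_  : Formula → Formula → Formula
  _∨_  : Formula → Formula → Formula

¬ₚ : Formula → Formula
¬ₚ B = B ⇒ ⊥ₚ

data Idx : Set where
  i₁ i₂ : Idx

-- KP-terms, with de Bruijn indices (α-equivalence built in).
-- lam t, case t s₁ s₂ and hop t s₁ s₂ bind index 0 in t (lam, hop) and s₁, s₂ (case, hop).
data Term : Set where
  var  : ℕ → Term
  app  : Term → Term → Term
  lam  : Term → Term
  efq  : Term → Term
  pair : Term → Term → Term
  proj : Idx → Term → Term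
  inj  : Idx → Term → Term
  case : Term → Term → Term → Term
  hop  : Term → Term → Term → Term

ext : (ℕ → ℕ) → ℕ → ℕ
ext ρ zero    = zero
ext ρ (suc n) = suc (ρ n)

rename : (ℕ → ℕ) → Term → Term
rename ρ (var x)        = var (ρ x)
rename ρ (app t s)      = app (rename ρ t) (rename ρ s)
rename ρ (lam t)        = lam (rename (ext ρ) t)
rename ρ (efq t)        = efq (rename ρ t)
rename ρ (pair t s)     = pair (rename ρ t) (rename ρ s)
rename ρ (proj i t)     = proj i (rename ρ t)
rename ρ (inj i t)      = inj i (rename ρ t)
rename ρ (case t s₁ s₂) = case (rename ρ t) (rename (ext ρ) s₁) (rename (ext ρ) s₂)
rename ρ (hop t s₁ s₂)  = hop (rename (ext ρ) t) (rename (ext ρ) s₁) (rename (ext ρ) s₂)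

exts : (ℕ → Term) → ℕ → Term
exts σ zero    = var zero
exts σ (suc n) = rename suc (σ n)

subst : (ℕ → Term) → Term → Term
subst σ (var x)        = σ x
subst σ (app t s)      = app (subst σ t) (subst σ s)
subst σ (lam t)        = lam (subst (exts σ) t)
subst σ (efq t)        = efq (subst σ t)
subst σ (pair t s)     = pair (subst σ t) (subst σ s)
subst σ (proj i t)     = proj i (subst σ t)
subst σ (inj i t)      = inj i (subst σ t)
subst σ (case t s₁ s₂) = case (subst σ t) (subst (exts σ) s₁) (subst (exts σ) s₂)
subst σ (hop t s₁ s₂)  = hop (subst (exts σ) t) (subst (exts σ) s₁) (subst (exts σ) s₂)

-- t {0 := s}: substitute s for the outermost bound variable 0, lowering the others
single : Term → ℕ → Term
single s zero    = s
single s (suc n) = var n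

_[_] : Term → Term → Term
t [ s ] = subst (single s) t

-- Contexts: lists of formulas; index 0 is the most recently bound variable.
Ctx : Set
Ctx = List Formula

data _∋_∶_ : Ctx → ℕ → Formula → Set where
  here  : ∀ {Γ A} → (A ∷ Γ) ∋ zero ∶ A
  there : ∀ {Γ A B x} → Γ ∋ x ∶ A → (B ∷ Γ) ∋ suc x ∶ A

proj-type : Idx → Formula → Formula → Formula
proj-type i₁ A B = A
proj-type i₂ A B = B

infix 4 _⊢_∶_
data _⊢_∶_ : Ctx → Term → Formula → Set where
  ax   : ∀ {Γ x A} → Γ ∋ x ∶ A → Γ ⊢ var x ∶ A
  ⇒I   : ∀ {Γ t A B} → (A ∷ Γ) ⊢ t ∶ B → Γ ⊢ lam t ∶ A ⇒ B
  ⇒E   : ∀ {Γ t s A B} → Γ ⊢ t ∶ A ⇒ B → Γ ⊢ s ∶ A → Γ ⊢ app t s ∶ B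
  ∧I   : ∀ {Γ t₁ t₂ A₁ A₂} → Γ ⊢ t₁ ∶ A₁ → Γ ⊢ t₂ ∶ A₂ → Γ ⊢ pair t₁ t₂ ∶ A₁ ∧ A₂
  ∧E   : ∀ {Γ t A₁ A₂} (i : Idx) → Γ ⊢ t ∶ A₁ ∧ A₂ → Γ ⊢ proj i t ∶ proj-type i A₁ A₂
  ∨I   : ∀ {Γ t A₁ A₂} (i : Idx) → Γ ⊢ t ∶ proj-type i A₁ A₂ → Γ ⊢ inj i t ∶ A₁ ∨ A₂
  ∨E   : ∀ {Γ t s₁ s₂ A₁ A₂ D} → Γ ⊢ t ∶ A₁ ∨ A₂ → (A₁ ∷ Γ) ⊢ s₁ ∶ D → (A₂ ∷ Γ) ⊢ s₂ ∶ D
         → Γ ⊢ case t s₁ s₂ ∶ D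
  ⊥E   : ∀ {Γ t A} → Γ ⊢ t ∶ ⊥ₚ → Γ ⊢ efq t ∶ A
  harrop : ∀ {Γ t s₁ s₂ B A₁ A₂ D}
         → (¬ₚ B ∷ Γ) ⊢ t ∶ A₁ ∨ A₂
         → ((¬ₚ B ⇒ A₁) ∷ Γ) ⊢ s₁ ∶ D
         → ((¬ₚ B ⇒ A₂) ∷ Γ) ⊢ s₂ ∶ D
         → Γ ⊢ hop t s₁ s₂ ∶ D

data WCtx : Set where
  □     : WCtx
  wapp  : WCtx → Term → WCtx
  wproj : Idx → WCtx → WCtx
  wcase : WCtx → Term → Term → WCtx

plug : WCtx → Term → Term
plug □ t             = t
plug (wapp W s) t    = app (plug W t) s
plug (wproj i W) t   = proj i (plug W t)
plug (wcase W s₁ s₂) t = case (plug W t) s₁ s₂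

branch : Idx → Term → Term → Term
branch i₁ s₁ s₂ = s₁
branch i₂ s₁ s₂ = s₂

proj-pair : Idx → Term → Term → Term
proj-pair = branch

infix 4 _↦_
data _↦_ : Term → Term → Set where
  β      : ∀ {t s} → app (lam t) s ↦ t [ s ]
  π-β    : ∀ {t₁ t₂} (i : Idx) → proj i (pair t₁ t₂) ↦ proj-pair i t₁ t₂
  case-β : ∀ {t s₁ s₂} (i : Idx) → case (inj i t) s₁ s₂ ↦ branch i s₁ s₂ [ t ]
  hop-in : ∀ {t s₁ s₂} (i : Idx) → hop (inj i t) s₁ s₂ ↦ branch i s₁ s₂ [ lam t ]
  hop-efq : ∀ {t s₁ s₂} (W : WCtx) → hop (plug W (efq t)) s₁ s₂ ↦ s₁ [ lam (efq t) ]

infix 4 _⟶_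
data _⟶_ : Term → Term → Set where
  top   : ∀ {t s} → t ↦ s → t ⟶ s
  appˡ  : ∀ {t t' s} → t ⟶ t' → app t s ⟶ app t' s
  appʳ  : ∀ {t s s'} → s ⟶ s' → app t s ⟶ app t s'
  lamᶜ  : ∀ {t t'} → t ⟶ t' → lam t ⟶ lam t'
  efqᶜ  : ∀ {t t'} → t ⟶ t' → efq t ⟶ efq t'
  pairˡ : ∀ {t t' s} → t ⟶ t' → pair t s ⟶ pair t' s
  pairʳ : ∀ {t s s'} → s ⟶ s' → pair t s ⟶ pair t s'
  projᶜ : ∀ {i t t'} → t ⟶ t' → proj i t ⟶ proj i t'
  injᶜ  : ∀ {i t t'} → t ⟶ t' → inj i t ⟶ inj i t'
  case₀ : ∀ {t t' s₁ s₂} → t ⟶ t' → case t s₁ s₂ ⟶ case t' s₁ s₂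
  case₁ : ∀ {t s₁ s₁' s₂} → s₁ ⟶ s₁' → case t s₁ s₂ ⟶ case t s₁' s₂
  case₂ : ∀ {t s₁ s₂ s₂'} → s₂ ⟶ s₂' → case t s₁ s₂ ⟶ case t s₁ s₂'
  hop₀  : ∀ {t t' s₁ s₂} → t ⟶ t' → hop t s₁ s₂ ⟶ hop t' s₁ s₂
  hop₁  : ∀ {t s₁ s₁' s₂} → s₁ ⟶ s₁' → hop t s₁ s₂ ⟶ hop t s₁' s₂
  hop₂  : ∀ {t s₁ s₂ s₂'} → s₂ ⟶ s₂' → hop t s₁ s₂ ⟶ hop t s₁ s₂'

module Submission where

-- The proof follows the usual pattern for natural-deduction calculi.
--  * Typing is stable under renamings and then under substitutions that
--    map each typed variable to a term of the same type; the single
--    substitution t [ s ] is the special case used by every redex.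
--  * A term plugged into a weak head context has a typable hole, so in
--    a Harrop redex hop (W⟨efq t⟩) s₁ s₂ the argument t proves ⊥.
--  * Each top-level rule ↦ then preserves types: β, projection and case
--    are substitution steps; for hop-in the hypothesis x : ¬B of the
--    Harrop premise is discharged by λ, giving the premise ¬B ⇒ Aᵢ of the
--    chosen branch; for hop-efq the term λx.efq t has type ¬B ⇒ A₁.
--  * Finally, type preservation by top-level steps lifts to the closure
--    under all term constructors by induction on the derivation of t ⟶ s,
--    which yields the theorem.

open import Defs
open import Data.Nat using (ℕ; zero; suc)
open import Data.List using (_∷_)
open import Data.Product using (∃; _,_)

Renaming : Ctx → Ctx → (ℕ → ℕ) → Set
Renaming Γ Δ ρ = ∀ {x A} → Γ ∋ x ∶ A → Δ ∋ ρ x ∶ A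

ext-renaming : ∀ {Γ Δ ρ B} → Renaming Γ Δ ρ → Renaming (B ∷ Γ) (B ∷ Δ) (ext ρ)
ext-renaming r here      = here
ext-renaming r (there x) = there (r x)

rename-typing : ∀ {Γ Δ ρ t A} → Renaming Γ Δ ρ → Γ ⊢ t ∶ A → Δ ⊢ rename ρ t ∶ A
rename-typing r (ax x)         = ax (r x)
rename-typing r (⇒I d)         = ⇒I (rename-typing (ext-renaming r) d)
rename-typing r (⇒E d e)       = ⇒E (rename-typing r d) (rename-typing r e)
rename-typing r (∧I d e)       = ∧I (rename-typing r d) (rename-typing r e)
rename-typing r (∧E i d)       = ∧E i (rename-typing r d)
rename-typing r (∨I i d)       = ∨I i (rename-typing r d)
rename-typing r (∨E d e f)     =
  ∨E (rename-typing r d) (rename-typing (ext-renaming r) e) (rename-typing (ext-renaming r) f)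
rename-typing r (⊥E d)         = ⊥E (rename-typing r d)
rename-typing r (harrop d e f) =
  harrop (rename-typing (ext-renaming r) d)
         (rename-typing (ext-renaming r) e)
         (rename-typing (ext-renaming r) f)

Substitution : Ctx → Ctx → (ℕ → Term) → Set
Substitution Γ Δ σ = ∀ {x A} → Γ ∋ x ∶ A → Δ ⊢ σ x ∶ A

exts-substitution : ∀ {Γ Δ σ B}
  → Substitution Γ Δ σ → Substitution (B ∷ Γ) (B ∷ Δ) (exts σ)
exts-substitution s here      = ax here
exts-substitution s (there x) = rename-typing there (s x)

subst-typing : ∀ {Γ Δ σ t A} → Substitution Γ Δ σ → Γ ⊢ t ∶ A → Δ ⊢ subst σ t ∶ A
subst-typing s (ax x)         = s x
subst-typing s (⇒I d)         = ⇒I (subst-typing (exts-substitution s) d)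
subst-typing s (⇒E d e)       = ⇒E (subst-typing s d) (subst-typing s e)
subst-typing s (∧I d e)       = ∧I (subst-typing s d) (subst-typing s e)
subst-typing s (∧E i d)       = ∧E i (subst-typing s d)
subst-typing s (∨I i d)       = ∨I i (subst-typing s d)
subst-typing s (∨E d e f)     =
  ∨E (subst-typing s d) (subst-typing (exts-substitution s) e) (subst-typing (exts-substitution s) f)
subst-typing s (⊥E d)         = ⊥E (subst-typing s d)
subst-typing s (harrop d e f) =
  harrop (subst-typing (exts-substitution s) d)
         (subst-typing (exts-substitution s) e)
         (subst-typing (exts-substitution s) f)

single-substitution : ∀ {Γ u B} → Γ ⊢ u ∶ B → Substitution (B ∷ Γ) Γ (single u)
single-substitution d here      = d
single-substitution d (there x) = ax x

substitution-lemma : ∀ {Γ t u A B} → (B ∷ Γ) ⊢ t ∶ A → Γ ⊢ u ∶ B → Γ ⊢ t [ u ] ∶ A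
substitution-lemma d e = subst-typing (single-substitution e) d

-- The term in the hole of a weak head context of a typable term is typable,
-- since weak head contexts never descend under a binder.
hole-typable : ∀ {Γ u A} (W : WCtx) → Γ ⊢ plug W u ∶ A → ∃ λ B → Γ ⊢ u ∶ B
hole-typable □               d          = _ , d
hole-typable (wapp W s)      (⇒E d e)   = hole-typable W d
hole-typable (wproj i W)     (∧E .i d)  = hole-typable W d
hole-typable (wcase W s₁ s₂) (∨E d e f) = hole-typable W d

efq-in-hole : ∀ {Γ t A} (W : WCtx) → Γ ⊢ plug W (efq t) ∶ A → Γ ⊢ t ∶ ⊥ₚ
efq-in-hole W d with hole-typable W d
... | _ , ⊥E e = e

top-subject-reduction : ∀ {Γ t s A} → Γ ⊢ t ∶ A → t ↦ s → Γ ⊢ s ∶ A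
top-subject-reduction (⇒E (⇒I d) e)        β            = substitution-lemma d e
top-subject-reduction (∧E i₁ (∧I d e))       (π-β .i₁)    = d
top-subject-reduction (∧E i₂ (∧I d e))       (π-β .i₂)    = e
top-subject-reduction (∨E (∨I i₁ d) e f)     (case-β .i₁) = substitution-lemma e d
top-subject-reduction (∨E (∨I i₂ d) e f)     (case-β .i₂) = substitution-lemma f d
top-subject-reduction (harrop (∨I i₁ d) e f) (hop-in .i₁) = substitution-lemma e (⇒I d)
top-subject-reduction (harrop (∨I i₂ d) e f) (hop-in .i₂) = substitution-lemma f (⇒I d)
top-subject-reduction (harrop d e f)         (hop-efq W)  =
  substitution-lemma e (⇒I (⊥E (efq-in-hole W d)))

lift-to-closure : (∀ {Γ t s A} → Γ ⊢ t ∶ A → t ↦ s → Γ ⊢ s ∶ A)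
  → ∀ {Γ t s A} → Γ ⊢ t ∶ A → t ⟶ s → Γ ⊢ s ∶ A
lift-to-closure top-sr = go
  where
  go : ∀ {Γ t s A} → Γ ⊢ t ∶ A → t ⟶ s → Γ ⊢ s ∶ A
  go d              (top r)   = top-sr d r
  go (⇒E d e)       (appˡ r)  = ⇒E (go d r) e
  go (⇒E d e)       (appʳ r)  = ⇒E d (go e r)
  go (⇒I d)         (lamᶜ r)  = ⇒I (go d r)
  go (⊥E d)         (efqᶜ r)  = ⊥E (go d r)
  go (∧I d e)       (pairˡ r) = ∧I (go d r) e
  go (∧I d e)       (pairʳ r) = ∧I d (go e r)
  go (∧E i d)       (projᶜ r) = ∧E i (go d r)
  go (∨I i d)       (injᶜ r)  = ∨I i (go d r)
  go (∨E d e f)     (case₀ r) = ∨E (go d r) e f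
  go (∨E d e f)     (case₁ r) = ∨E d (go e r) f
  go (∨E d e f)     (case₂ r) = ∨E d e (go f r)
  go (harrop d e f) (hop₀ r)  = harrop (go d r) e f
  go (harrop d e f) (hop₁ r)  = harrop d (go e r) f
  go (harrop d e f) (hop₂ r)  = harrop d e (go f r)

mainTheorem5 : ∀ {Γ : Ctx} {t s : Term} {A : Formula}
    → Γ ⊢ t ∶ A → t ⟶ s → Γ ⊢ s ∶ A
mainTheorem5 = lift-to-closure top-subject-reduction
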